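{- In the setting of the context, let $\vec v_0,\dots,\vec v_m$ be all the values successively taken by the variable $t$ at the beginning of the loop body of $\mathcal{H}_m(\mathcal{M},\forall\vec x\,\varphi)$, and let $\vec v_{max}$ be the maximum element of $\mathbf V_{\vec x}$. Then for all $j=1,\dots,m$: (1) $\vec v_{j-1}<\vec v_j$; (2) for all $\vec u$ with $\vec v_{j-1}\le\vec u<\vec v_j$, $\mathcal{M}\models\varphi\{\vec x\mapsto\vec u\}$ iff $\mathcal{M}\models\varphi\{\vec x\mapsto\vec v_{j-1}\}$; (3) for all $\vec u$ with $\vec v_m\le\vec u\le\vec v_{max}$, $\mathcal{M}\models\varphi\{\vec x\mapsto\vec u\}$ iff $\mathcal{M}\models\varphi\{\vec x\mapsto\vec v_m\}$.
   Context: $\mathcal{M}$ is an interpretation and $\varphi$ a quantifier-free formula with free variables among $\vec x=(x_1,\dots,x_n)$, $x_i$ of sort $S_i$, where each $S_i$ is interpreted in $\mathcal{M}$ as a finite nonempty set $\mathbf V_{S_i}$ of elements, each named by a term. Let $\mathbf V_{\vec x}=\mathbf V_{S_1}\times\dots\times\mathbf V_{S_n}$, fix a total order $<_{S}$ on each $\mathbf V_S$, and let $<$ be the lexicographic order on $\mathbf V_{\vec x}$ (position 1 most significant); $\vec v_{min}$ is its minimum. For $\vec v\in\mathbf V_{\vec x}$ and integer $i\ge1$, $\mathrm{next}_i(\vec v)$ is the smallest (w.r.t. $<$) tuple $\vec u$ with $\vec v<\vec u$ and $\vec u(j)\ne\vec v(j)$ for some $1\le j\le n+1-i$, if one exists,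 and $\vec v_{min}$ otherwise (in particular whenever $i>n$). The procedure $\mathsf{eval}(\mathcal{M},\varphi,\sigma)$, for a substitution $\sigma$ mapping $\vec x$ to $\mathbf V_{\vec x}$, returns a pair $(v,X)$ where $v\in\{\mathsf{true},\mathsf{false}\}$ is the truth value of $\varphi\sigma$ in $\mathcal{M}$ and $X\subseteq\{x_1,\dots,x_n\}$ (the critical variables) is such that $\varphi\sigma'$ has the same truth value $v$ in $\mathcal M$ for every substitution $\sigma'$ into $\mathbf V_{\vec x}$ agreeing with $\sigma$ on $X$. Procedure $\mathcal{H}_m(\mathcal{M},\forall\vec x\,\varphi)$: set $\Theta:=\emptyset$, $t:=\vec v_{min}$; repeat: let $(v,\{x_{i_1},\dots,x_{i_p}\}):=\mathsf{eval}(\mathcal M,\varphi,\{\vec x\mapsto t\})$; if $v=\mathsf{false}$ add $\{\vec x\mapsto t\}$ to $\Theta$; set $t:=\mathrm{next}_i(t)$ with $i=n+1-\max\{0,i_1,\dots,i_p\}$; until $t=\vec v_{min}$; return $\Theta$. -}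

module Defs where

open import Data.Nat using (ℕ; zero; suc; _+_; _∸_; _⊔_; _<_)
open import Data.Fin using (Fin; toℕ; fromℕ) renaming (_<_ to _<ᶠ_; zero to fzero; suc to fsuc)
open import Data.List using (List; []; _∷_; length; foldr)
open import Data.Bool using (Bool)
open import Data.Product using (_×_; _,_; Σ; proj₁; proj₂)
open import Data.Sum using (_⊎_)
open import Data.Unit using (⊤; tt)
open import Relation.Binary.PropositionalEquality using (_≡_; _≢_)
open import Relation.Nullary using (¬_)

-- A signature of sorts for the variables x₁ … xₙ: the list ks = (k₁,…,kₙ)
-- means that xᵢ ranges over V_{Sᵢ} = Fin (suc kᵢ) (a finite nonempty set),
-- whose total order <_{Sᵢ} is the natural order of Fin.
-- Tuple ks is V_x = V_{S₁} × … × V_{Sₙ}; position 1 is the head.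
Tuple : List ℕ → Set
Tuple []       = ⊤
Tuple (k ∷ ks) = Fin (suc k) × Tuple ks

_<L_ : {ks : List ℕ} → Tuple ks → Tuple ks → Set
_<L_ {[]}     _        _        = Data.Empty.⊥
  where import Data.Empty
_<L_ {k ∷ ks} (a , as) (b , bs) = (a <ᶠ b) ⊎ ((a ≡ b) × (as <L bs))

_≤L_ : {ks : List ℕ} → Tuple ks → Tuple ks → Set
u ≤L v = (u ≡ v) ⊎ (u <L v)

vmin : (ks : List ℕ) → Tuple ks
vmin []       = tt
vmin (k ∷ ks) = fzero , vmin ks

vmax : (ks : List ℕ) → Tuple ks
vmax []       = tt
vmax (k ∷ ks) = fromℕ k , vmax ks

-- value (as a natural number) of the component at 0-based position j
-- (i.e. of the variable x_{j+1})
comp : {ks : List ℕ} → Tuple ks → Fin (length ks) → ℕ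
comp {k ∷ ks} (a , as) fzero    = toℕ a
comp {k ∷ ks} (a , as) (fsuc j) = comp as j

-- Cand i v u : v < u and u(j) ≠ v(j) for some 1 ≤ j ≤ n+1-i
-- (0-based position p = j-1, so toℕ p < n+1-i)
Cand : {ks : List ℕ} → ℕ → Tuple ks → Tuple ks → Set
Cand {ks} i v u =
  (v <L u) × Σ (Fin (length ks)) (λ p → (toℕ p < (length ks + 1 ∸ i)) × (comp u p ≢ comp v p))

-- IsNext i v u : u = next_i(v), i.e. u is the smallest candidate if one
-- exists, and u = v_min otherwise.
IsNext : {ks : List ℕ} → ℕ → Tuple ks → Tuple ks → Set
IsNext {ks} i v u =
  (Cand i v u × (∀ w → Cand i v w → u ≤L w))
  ⊎ ((∀ w → ¬ Cand i v w) × (u ≡ vmin ks))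

-- A critical-variable set {x_{i₁},…,x_{i_p}} is given as a list of
-- 0-based positions; maxIdx computes max{0, i₁, …, i_p} (1-based indices).
maxIdx : {n : ℕ} → List (Fin n) → ℕ
maxIdx = foldr (λ p acc → suc (toℕ p) ⊔ acc) 0

-- Specification of eval for the formula whose truth value at a tuple
-- (i.e. the truth value of φ{x ↦ t} in M) is given by φ.
EvalSpec : {ks : List ℕ} → (Tuple ks → Bool) → (Tuple ks → Bool × List (Fin (length ks))) → Set
EvalSpec {ks} φ eval =
  ∀ t → (proj₁ (eval t) ≡ φ t)
      × (∀ u → (∀ p → p Data.List.Membership.Propositional.∈ proj₂ (eval t) → comp u p ≡ comp t p)
             → φ u ≡ φ t)
  where import Data.List.Membership.Propositional

-- The index i used in the update t := next_i(t) of H_m.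
stepIndex : {ks : List ℕ} → (Tuple ks → Bool × List (Fin (length ks))) → Tuple ks → ℕ
stepIndex {ks} eval t = length ks + 1 ∸ maxIdx (proj₂ (eval t))

-- Each step of the loop jumps from t to next_i(t), where i is chosen so that
-- every critical variable of φ at t lies among the first n+1-i positions.
-- A tuple u with t < u that is skipped by the jump is therefore no candidate
-- for next_i(t), so it agrees with t on all critical variables and φ takes
-- the same value at u as at t. The final jump wraps around to v_min, which
-- happens only when no candidate exists at all, so φ is constant from the
-- last visited tuple up to v_max.
module Submission where

open import Defs
open import Data.Nat using (ℕ; suc; _≤_; _<_; _+_; _∸_; z≤n)
open import Data.Nat.Properties
  using (m∸[m∸n]≡n; m≤m⊔n; m≤n⊔m; ⊔-lub; ≤-trans; m≤n⇒m≤n+o; _≟_; <⇒≤; ≤-refl)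
open import Data.Bool using (Bool)
open import Data.Fin using (Fin; toℕ)
import Data.Fin.Properties as Fin
open import Data.List using (List; length; []; _∷_)
open import Data.List.Membership.Propositional using (_∈_)
open import Data.List.Relation.Unary.Any using (here; there)
open import Data.Product using (_×_; _,_; proj₂)
open import Data.Sum using (inj₁; inj₂)
open import Relation.Nullary using (¬_; yes; no; contradiction)
open import Relation.Binary.PropositionalEquality using (_≡_; _≢_; refl; sym; subst)

<L-irrefl : {ks : List ℕ} (u : Tuple ks) → ¬ (u <L u)
<L-irrefl {k ∷ ks} (a , as) (inj₁ a<a)      = Fin.<-irrefl refl a<a
<L-irrefl {k ∷ ks} (a , as) (inj₂ (_ , r)) = <L-irrefl as r

<L-asym : {ks : List ℕ} {u v : Tuple ks} → u <L v → ¬ (v <L u)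
<L-asym {k ∷ ks} (inj₁ a<b)         (inj₁ b<a)         = Fin.<-asym a<b b<a
<L-asym {k ∷ ks} (inj₁ a<a)         (inj₂ (refl , _)) = Fin.<-irrefl refl a<a
<L-asym {k ∷ ks} (inj₂ (refl , _)) (inj₁ a<a)         = Fin.<-irrefl refl a<a
<L-asym {k ∷ ks} (inj₂ (_ , r))     (inj₂ (_ , s))     = <L-asym r s

<L⇒≱L : {ks : List ℕ} {u v : Tuple ks} → u <L v → ¬ (v ≤L u)
<L⇒≱L {u = u} u<u (inj₁ refl) = <L-irrefl u u<u
<L⇒≱L u<v (inj₂ v<u)           = <L-asym u<v v<u

≮L-vmin : {ks : List ℕ} (t : Tuple ks) → ¬ (t <L vmin ks)
≮L-vmin {k ∷ ks} (a , as) (inj₁ ())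
≮L-vmin {k ∷ ks} (a , as) (inj₂ (_ , r)) = ≮L-vmin as r

maxIdx≤n : {n : ℕ} (ps : List (Fin n)) → maxIdx ps ≤ n
maxIdx≤n []       = z≤n
maxIdx≤n (p ∷ ps) = ⊔-lub (Fin.toℕ<n p) (maxIdx≤n ps)

∈⇒<maxIdx : {n : ℕ} {p : Fin n} {ps : List (Fin n)} → p ∈ ps → toℕ p < maxIdx ps
∈⇒<maxIdx {p = p} {_ ∷ ps} (here refl) = m≤m⊔n (suc (toℕ p)) (maxIdx ps)
∈⇒<maxIdx {ps = q ∷ ps} (there p∈ps) =
  ≤-trans (∈⇒<maxIdx p∈ps) (m≤n⊔m (suc (toℕ q)) (maxIdx ps))

module _ {ks : List ℕ} {φ : Tuple ks → Bool}
         {eval : Tuple ks → Bool × List (Fin (length ks))} (spec : EvalSpec φ eval) where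

  critical-in-window : (t : Tuple ks) {p : Fin (length ks)} → p ∈ proj₂ (eval t) →
                       toℕ p < length ks + 1 ∸ stepIndex eval t
  critical-in-window t {p} p∈crit =
    subst (toℕ p <_) (sym (m∸[m∸n]≡n (m≤n⇒m≤n+o 1 (maxIdx≤n crit)))) (∈⇒<maxIdx p∈crit)
    where crit = proj₂ (eval t)

  ¬Cand⇒φ-agrees : (t u : Tuple ks) → t ≤L u → ¬ Cand (stepIndex eval t) t u → φ u ≡ φ t
  ¬Cand⇒φ-agrees t .t (inj₁ refl) _ = refl
  ¬Cand⇒φ-agrees t u (inj₂ t<u) ¬cand = proj₂ (spec t) u agrees-on-critical
    where
    agrees-on-critical : ∀ p → p ∈ proj₂ (eval t) → comp u p ≡ comp t p
    agrees-on-critical p p∈crit with comp u p ≟ comp t p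
    ... | yes eq = eq
    ... | no neq = contradiction (t<u , p , critical-in-window t p∈crit , neq) ¬cand

module _ {ks : List ℕ} (i : ℕ) (v : Tuple ks) where

  IsNext⇒<L : {u : Tuple ks} → IsNext i v u → u ≢ vmin ks → v <L u
  IsNext⇒<L (inj₁ ((v<u , _) , _)) _      = v<u
  IsNext⇒<L (inj₂ (_ , u≡vmin))    u≢vmin = contradiction u≡vmin u≢vmin

  IsNext⇒¬Cand-below : {u w : Tuple ks} → IsNext i v u → w <L u → ¬ Cand i v w
  IsNext⇒¬Cand-below (inj₁ (_ , least)) w<u cand = <L⇒≱L w<u (least _ cand)
  IsNext⇒¬Cand-below (inj₂ (none , _))  _   cand = none _ cand

  IsNext-vmin⇒¬Cand : {w : Tuple ks} → IsNext i v (vmin ks) → ¬ Cand i v w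
  IsNext-vmin⇒¬Cand (inj₁ ((v<vmin , _) , _)) _ = ≮L-vmin v v<vmin
  IsNext-vmin⇒¬Cand (inj₂ (none , _))          = none _

lemma3 : (ks : List ℕ) (φ : Tuple ks → Bool)
    (eval : Tuple ks → Bool × List (Fin (length ks))) → EvalSpec φ eval →
    (vs : ℕ → Tuple ks) (m : ℕ) →
    vs 0 ≡ vmin ks →
    (∀ j → j ≤ m → IsNext (stepIndex eval (vs j)) (vs j) (vs (suc j))) →
    (∀ j → j < m → vs (suc j) ≢ vmin ks) →
    vs (suc m) ≡ vmin ks →
    (∀ j → j < m →
    (vs j <L vs (suc j))
    × (∀ u → vs j ≤L u → u <L vs (suc j) → φ u ≡ φ (vs j)))
    × (∀ u → vs m ≤L u → u ≤L vmax ks → φ u ≡ φ (vs m))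
lemma3 ks φ eval spec vs m _ step nonfinal final = inner-step , last-step
  where
  i : ℕ → ℕ
  i j = stepIndex eval (vs j)

  inner-step : ∀ j → j < m → (vs j <L vs (suc j))
             × (∀ u → vs j ≤L u → u <L vs (suc j) → φ u ≡ φ (vs j))
  inner-step j j<m =
      IsNext⇒<L (i j) (vs j) (step j (<⇒≤ j<m)) (nonfinal j j<m)
    , λ u vj≤u u<next → ¬Cand⇒φ-agrees spec (vs j) u vj≤u
        (IsNext⇒¬Cand-below (i j) (vs j) (step j (<⇒≤ j<m)) u<next)

  last-step : ∀ u → vs m ≤L u → u ≤L vmax ks → φ u ≡ φ (vs m)
  last-step u vm≤u _ = ¬Cand⇒φ-agrees spec (vs m) u vm≤u
    (IsNext-vmin⇒¬Cand (i m) (vs m) (subst (IsNext (i m) (vs m)) final (step m ≤-refl)))
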